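{- Let $\mathcal{B}$ be a saturated set, $\mathcal{M}$ a $\mathcal{B}$-model and $\mathcal{S}\in\mathcal{M}$. Then $\mathcal{S}=\mathcal{S}^{\mathcal{B}}\leadsto\mathcal{B}$.
   Context: $\lambda\mu$-terms: $\mathcal{T} ::= x \mid \lambda x.\mathcal{T} \mid (\mathcal{T})\mathcal{T} \mid [\alpha]\mathcal{T} \mid \mu\alpha.\mathcal{T}$, up to renaming of bound variables; substitutions avoid capture. Types $A ::= X \mid \bot \mid A\to B$; typing judgments $\Gamma\vdash M:A;\Theta$ by: $\Gamma,x:A\vdash x:A;\Theta$; from $\Gamma,x:A\vdash M:B;\Theta$ infer $\Gamma\vdash\lambda x.M:A\to B;\Theta$; from $\Gamma\vdash M:A\to B;\Theta$, $\Gamma\vdash N:A;\Theta$ infer $\Gamma\vdash(M)N:B;\Theta$; from $\Gamma\vdash M:A;\alpha:A,\Theta$ infer $\Gamma\vdash[\alpha]M:\bot;\alpha:A,\Theta$; from $\Gamma\vdash M:\bot;\alpha:A,\Theta$ infer $\Gamma\vdash\mu\alpha.M:A;\Theta$. $\mathcal{T}_t$ = typable terms. $(M)P_1\dots P_k=(\dots((M)P_1)\dots)P_k$, $(M)\varnothing=M$; $\bar P\sqsubseteq\bar N$: initial segment; $\mathcal{L}^{<\omega}$ finite sequences. $M[\alpha:=_rN]$ replaces inductively each $[\alpha]P$ by $[\alpha](P')N$; $M[\alpha:=_rN_1\dots N_n]=M[\alpha:=_rN_1]\dots[\alpha:=_rN_n]$. Saturated set: $\mathcal{B}\subseteq\mathcal{T}_t$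 with (C1) $M\in\mathcal{B}\Rightarrow\lambda x.M\in\mathcal{B}$; (C2) $M\in\mathcal{B}$, $\mu\alpha.M\in\mathcal{T}_t\Rightarrow\mu\alpha.M\in\mathcal{B}$; (C3) $M\in\mathcal{B}$, $[\alpha]M\in\mathcal{T}_t\Rightarrow[\alpha]M\in\mathcal{B}$; (C4) $n\ge0$, $N_i\in\mathcal{B}$, $(x)N_1\dots N_n\in\mathcal{T}_t\Rightarrow(x)N_1\dots N_n\in\mathcal{B}$; (C5) $M,N\in\mathcal{T}_t$, $\bar P\in\mathcal{T}_t^{<\omega}$, $N\in\mathcal{B}$, $(\lambda x.M)N\bar P\in\mathcal{T}_t$, $(M[x:=N])\bar P\in\mathcal{B}\Rightarrow(\lambda x.M)N\bar P\in\mathcal{B}$; (C6) $M\in\mathcal{T}_t$, $\bar N\in\mathcal{B}^{<\omega}$, $(\mu\alpha.M)\bar N\in\mathcal{T}_t$, $\mu\alpha.M[\alpha:=_r\bar N]\in\mathcal{B}\Rightarrow(\mu\alpha.M)\bar N\in\mathcal{B}$. For sets of terms $\mathcal{K},\mathcal{L}\subseteq\mathcal{B}$: $\mathcal{K}\leadsto\mathcal{L}=\{M\in\mathcal{B}\mid\forall N\in\mathcal{K},(M)N\in\mathcal{T}_t\Rightarrow(M)N\in\mathcal{L}\}$; for sets of sequences $\mathcal{X}\subseteq\mathcal{B}^{<\omega}$: $\mathcal{X}\leadsto\mathcal{B}=\{M\in\mathcal{B}\mid\forall\bar N\in\mathcal{X},\forall\bar P\sqsubseteq\bar N,(M)\bar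 P\in\mathcal{T}_t\Rightarrow(M)\bar P\in\mathcal{B}\}$. $\mathcal{S}\subseteq\mathcal{B}$ is $\mathcal{B}$-saturated if (D1) for $M,N\in\mathcal{T}_t$, $\bar P\in\mathcal{T}_t^{<\omega}$, $N\in\mathcal{B}$, $(\lambda x.M)N\bar P\in\mathcal{T}_t$ and $(M[x:=N])\bar P\in\mathcal{S}$ imply $(\lambda x.M)N\bar P\in\mathcal{S}$; (D2) for $N_1,\dots,N_n\in\mathcal{B}$, $(x)N_1\dots N_n\in\mathcal{T}_t$ implies it is in $\mathcal{S}$; (D3) $\mathcal{S}=\mathcal{X}_{\mathcal{S}}\leadsto\mathcal{B}$ for some $\mathcal{X}_{\mathcal{S}}\subseteq\mathcal{B}^{<\omega}$. A $\mathcal{B}$-model (given $\mathcal{B}$-saturated sets $(\mathcal{S}_i)_{i\in I}$) is the smallest set $\mathcal{M}$ containing $\mathcal{B}$ and all $\mathcal{S}_i$ and closed under $(\mathcal{U},\mathcal{V})\mapsto\mathcal{U}\leadsto\mathcal{V}$. For $\mathcal{S}\in\mathcal{M}$: $\mathcal{S}^{\mathcal{B}}=\left(\bigcup\{\mathcal{X}\subseteq\mathcal{B}^{<\omega}\mid\mathcal{S}=\mathcal{X}\leadsto\mathcal{B}\}\right)\cup\{\varnothing\}$, where $\varnothing$ is the empty sequence. -}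

module Defs where

open import Level using (Level; _⊔_) renaming (zero to 0ℓ; suc to lsuc)
open import Data.Nat using (ℕ; zero; suc; _≟_)
open import Data.List using (List; []; _∷_; _++_; foldl; map)
open import Data.List.Relation.Unary.All using (All)
open import Data.Product using (Σ; _×_; ∃)
open import Data.Sum using (_⊎_)
open import Relation.Nullary using (yes; no)
open import Relation.Unary using (Pred; _⊆_; _≐_)
open import Relation.Binary.PropositionalEquality using (_≡_)

-- λμ-terms, de Bruijn style (two independent sorts of variables:
-- λ-variables, bound by lam, and μ-variables, bound by mu).
-- Terms are thus identified up to renaming of bound variables.

data Term : Set where
  var : ℕ → Term
  lam : Term → Term
  app : Term → Term → Term
  nam : ℕ → Term → Term
  mu  : Term → Term

apps : Term → List Term → Term
apps = foldl app

liftR : (ℕ → ℕ) → ℕ → ℕ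
liftR ρ zero    = zero
liftR ρ (suc i) = suc (ρ i)

renλ : (ℕ → ℕ) → Term → Term
renλ ρ (var i)   = var (ρ i)
renλ ρ (lam M)   = lam (renλ (liftR ρ) M)
renλ ρ (app M N) = app (renλ ρ M) (renλ ρ N)
renλ ρ (nam a M) = nam a (renλ ρ M)
renλ ρ (mu M)    = mu (renλ ρ M)

renμ : (ℕ → ℕ) → Term → Term
renμ ρ (var i)   = var i
renμ ρ (lam M)   = lam (renμ ρ M)
renμ ρ (app M N) = app (renμ ρ M) (renμ ρ N)
renμ ρ (nam a M) = nam (ρ a) (renμ ρ M)
renμ ρ (mu M)    = mu (renμ (liftR ρ) M)

extsλ : (ℕ → Term) → ℕ → Term
extsλ σ zero    = var zero
extsλ σ (suc i) = renλ suc (σ i)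

sub : (ℕ → Term) → Term → Term
sub σ (var i)   = σ i
sub σ (lam M)   = lam (sub (extsλ σ) M)
sub σ (app M N) = app (sub σ M) (sub σ N)
sub σ (nam a M) = nam a (sub σ M)
sub σ (mu M)    = mu (sub (λ i → renμ suc (σ i)) M)

single : Term → ℕ → Term
single N zero    = N
single N (suc i) = var i

-- M[x:=N], where x is the λ-variable bound (index 0) in the body M
sub1 : Term → Term → Term
sub1 M N = sub (single N) M

rsub : ℕ → Term → Term → Term
rsub a N (var i)   = var i
rsub a N (lam M)   = lam (rsub a (renλ suc N) M)
rsub a N (app M P) = app (rsub a N M) (rsub a N P)
rsub a N (nam b M) with b ≟ a
... | yes _ = nam b (app (rsub a N M) N)
... | no  _ = nam b (rsub a N M)
rsub a N (mu M)    = mu (rsub (suc a) (renμ suc N) M)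

rsubs : ℕ → List Term → Term → Term
rsubs a []       M = M
rsubs a (N ∷ Ns) M = rsubs a Ns (rsub a N M)

-- μα.M[α:=_r N̄] for the term μα.M (α = bound μ-index 0; the Nᵢ are
-- shifted since they are moved under the μ-binder)
muRsubs : Term → List Term → Term
muRsubs M Ns = mu (rsubs zero (map (renμ suc) Ns) M)

data Ty : Set where
  atom : ℕ → Ty
  ⊥ty  : Ty
  _⇒_  : Ty → Ty → Ty

Ctx : Set
Ctx = ℕ → Ty

_▸_ : Ctx → Ty → Ctx
(Γ ▸ A) zero    = A
(Γ ▸ A) (suc i) = Γ i

data _⊢_∶_⨾_ : Ctx → Term → Ty → Ctx → Set where
  tvar : ∀ {Γ Θ i} → Γ ⊢ var i ∶ Γ i ⨾ Θ
  tlam : ∀ {Γ Θ A B M} → (Γ ▸ A) ⊢ M ∶ B ⨾ Θ → Γ ⊢ lam M ∶ (A ⇒ B) ⨾ Θ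
  tapp : ∀ {Γ Θ A B M N} → Γ ⊢ M ∶ (A ⇒ B) ⨾ Θ → Γ ⊢ N ∶ A ⨾ Θ →
         Γ ⊢ app M N ∶ B ⨾ Θ
  tnam : ∀ {Γ Θ a M} → Γ ⊢ M ∶ Θ a ⨾ Θ → Γ ⊢ nam a M ∶ ⊥ty ⨾ Θ
  tmu  : ∀ {Γ Θ A M} → Γ ⊢ M ∶ ⊥ty ⨾ (Θ ▸ A) → Γ ⊢ mu M ∶ A ⨾ Θ

Typable : Pred Term 0ℓ
Typable M = Σ Ctx λ Γ → Σ Ctx λ Θ → Σ Ty λ A → Γ ⊢ M ∶ A ⨾ Θ

record Saturated (B : Pred Term 0ℓ) : Set where
  field
    typ : B ⊆ Typable
    C1  : ∀ M → B M → B (lam M)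
    C2  : ∀ M → B M → Typable (mu M) → B (mu M)
    C3  : ∀ a M → B M → Typable (nam a M) → B (nam a M)
    C4  : ∀ x Ns → All B Ns → Typable (apps (var x) Ns) → B (apps (var x) Ns)
    C5  : ∀ M N Ps → Typable M → Typable N → All Typable Ps → B N →
          Typable (apps (app (lam M) N) Ps) → B (apps (sub1 M N) Ps) →
          B (apps (app (lam M) N) Ps)
    C6  : ∀ M Ns → Typable M → All B Ns → Typable (apps (mu M) Ns) →
          B (muRsubs M Ns) → B (apps (mu M) Ns)

_⊑_ : List Term → List Term → Set
Ps ⊑ Ns = ∃ λ Qs → Ps ++ Qs ≡ Ns

_⇝[_]_ : ∀ {ℓ₁ ℓ₂} → Pred Term ℓ₁ → Pred Term 0ℓ → Pred Term ℓ₂ →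
         Pred Term (ℓ₁ ⊔ ℓ₂)
(K ⇝[ B ] L) M = B M × (∀ N → K N → Typable (app M N) → L (app M N))

_⇝ˢ_ : ∀ {ℓ} → Pred (List Term) ℓ → Pred Term 0ℓ → Pred Term ℓ
(X ⇝ˢ B) M = B M × (∀ Ns → X Ns → ∀ Ps → Ps ⊑ Ns →
                     Typable (apps M Ps) → B (apps M Ps))

SeqsOf : ∀ {ℓ} → Pred Term 0ℓ → Pred (List Term) ℓ → Set ℓ
SeqsOf B X = ∀ Ns → X Ns → All B Ns

record BSaturated (B : Pred Term 0ℓ) (S : Pred Term 0ℓ) : Set₁ where
  field
    sub⊆ : S ⊆ B
    D1 : ∀ M N Ps → Typable M → Typable N → All Typable Ps → B N →
         Typable (apps (app (lam M) N) Ps) → S (apps (sub1 M N) Ps) →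
         S (apps (app (lam M) N) Ps)
    D2 : ∀ x Ns → All B Ns → Typable (apps (var x) Ns) → S (apps (var x) Ns)
    D3 : Σ (Pred (List Term) 0ℓ) λ X → SeqsOf B X × (S ≐ (X ⇝ˢ B))

-- membership in the B-model generated by the B-saturated sets (Sᵢ)ᵢ∈I:
-- the smallest family containing B and all Sᵢ, closed under ⇝
data InModel (B : Pred Term 0ℓ) {I : Set} (Sf : I → Pred Term 0ℓ) :
             Pred Term 0ℓ → Set₁ where
  base : InModel B Sf B
  gen  : ∀ i → InModel B Sf (Sf i)
  arr  : ∀ {U V} → InModel B Sf U → InModel B Sf V →
         InModel B Sf (U ⇝[ B ] V)

SB : Pred Term 0ℓ → Pred Term 0ℓ → Pred (List Term) (lsuc 0ℓ)
SB B S Ns = (Ns ≡ []) ⊎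
  Σ (Pred (List Term) 0ℓ) λ X → SeqsOf B X × (S ≐ (X ⇝ˢ B)) × X Ns

-- Every member of a B-model is of the form 𝒳 ⇝ B: for B take 𝒳 = {∅}, for
-- the generators use (D3), and for 𝒰 ⇝ 𝒱 take the sequences N N̄ with N ∈ 𝒰
-- and N̄ either empty or in a representing set of 𝒱. Given one such 𝒳, the
-- set 𝒮^B is the union of all of them together with ∅; since ⇝ B is
-- antitone, 𝒮^B ⇝ B lies in 𝒳 ⇝ B = 𝒮; conversely 𝒮 ⊆ 𝒳′ ⇝ B for every
-- representing 𝒳′, and ∅ only demands 𝒮 ⊆ B.
module Submission where

open import Defs
open import Level as Level using (Level) renaming (zero to 0ℓ)
open import Relation.Unary using (Pred; _⊆_; _≐_)
open import Data.List using (List; []; _∷_; _++_)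
open import Data.List.Relation.Unary.All using ([]; _∷_)
open import Data.Product using (Σ; _×_; _,_; proj₁; proj₂)
open import Data.Sum using (_⊎_; inj₁; inj₂)
open import Data.Empty using () renaming (⊥ to Empty)
open import Function using (_∘_)
open import Relation.Binary.PropositionalEquality using (_≡_; refl; cong)

private variable
  ℓ ℓ′ : Level
  B U V S : Pred Term 0ℓ
  X : Pred (List Term) 0ℓ
  M : Term
  Ps : List Term

Represents : Pred Term 0ℓ → Pred (List Term) 0ℓ → Pred Term 0ℓ → Set
Represents B X S = SeqsOf B X × (S ≐ (X ⇝ˢ B))

Representable : Pred Term 0ℓ → Pred Term 0ℓ → Set₁
Representable B S = Σ (Pred (List Term) 0ℓ) λ X → Represents B X S

representable⇒⊆ : Representable B S → S ⊆ B
representable⇒⊆ (_ , _ , S⊆X⇝B , _) = proj₁ ∘ S⊆X⇝B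

⊑-[] : Ps ⊑ [] → Ps ≡ []
⊑-[] {[]}    _       = refl
⊑-[] {_ ∷ _} (_ , ())

apps-⊑-[] : B M → Ps ⊑ [] → B (apps M Ps)
apps-⊑-[] bM p with ⊑-[] p
... | refl = bM

apps-typable⁻ : ∀ {M} Ps → Typable (apps M Ps) → Typable M
apps-typable⁻ []       t = t
apps-typable⁻ (P ∷ Ps) t with apps-typable⁻ Ps t
... | Γ , Θ , _ , tapp d _ = Γ , Θ , _ , d

⇝ˢ-antitone : {X : Pred (List Term) ℓ} {Y : Pred (List Term) ℓ′} →
              X ⊆ Y → (Y ⇝ˢ B) ⊆ (X ⇝ˢ B)
⇝ˢ-antitone X⊆Y (bM , f) = bM , λ Ns x → f Ns (X⊆Y x)

withEmpty : Pred (List Term) ℓ → Pred (List Term) ℓ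
withEmpty X Ns = (Ns ≡ []) ⊎ X Ns

⇝ˢ-withEmpty : {X : Pred (List Term) ℓ} → (X ⇝ˢ B) ⊆ (withEmpty X ⇝ˢ B)
⇝ˢ-withEmpty {B = B} (bM , f) = bM , λ where
  .[] (inj₁ refl) Ps p _ → apps-⊑-[] {B = B} bM p
  Ns  (inj₂ x)           → f Ns x

_∷ˢ_ : Pred Term 0ℓ → Pred (List Term) 0ℓ → Pred (List Term) 0ℓ
(U ∷ˢ X) []       = Empty
(U ∷ˢ X) (N ∷ Ns) = U N × X Ns

represents-B : Represents B (λ Ns → Ns ≡ []) B
represents-B {B} = (λ { .[] refl → [] })
             , (λ bM → bM , λ { .[] refl Ps p _ → apps-⊑-[] {B = B} bM p })
             , proj₁

represents-⇝ : U ⊆ B → Represents B X V →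
               Represents B (U ∷ˢ withEmpty X) (U ⇝[ B ] V)
represents-⇝ {U = U} {B} {X} {V} U⊆B (X⊆B* , V⊆X⇝B , X⇝B⊆V) =
  seqs , to , from
  where
  seqs : SeqsOf B (U ∷ˢ withEmpty X)
  seqs (N ∷ .[]) (uN , inj₁ refl) = U⊆B uN ∷ []
  seqs (N ∷ Ns)  (uN , inj₂ x)    = U⊆B uN ∷ X⊆B* Ns x

  to : (U ⇝[ B ] V) ⊆ ((U ∷ˢ withEmpty X) ⇝ˢ B)
  to (bM , f) = bM , λ where
    (N ∷ Ns) _ [] _ _ → bM
    (N ∷ .(Ps ++ Qs)) (uN , x) (.N ∷ Ps) (Qs , refl) t →
      let MN∈X⇝B = ⇝ˢ-withEmpty {B = B} (V⊆X⇝B (f N uN (apps-typable⁻ Ps t)))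
      in proj₂ MN∈X⇝B (Ps ++ Qs) x Ps (Qs , refl) t

  from : ((U ∷ˢ withEmpty X) ⇝ˢ B) ⊆ (U ⇝[ B ] V)
  from (bM , f) = bM , λ N uN t →
    X⇝B⊆V ( f (N ∷ []) (uN , inj₁ refl) (N ∷ []) ([] , refl) t
          , λ Ns x Ps (Qs , e) → f (N ∷ Ns) (uN , inj₂ x) (N ∷ Ps) (Qs , cong (N ∷_) e))

model-representable : {I : Set} (Sf : I → Pred Term 0ℓ) →
                      (∀ i → BSaturated B (Sf i)) →
                      InModel B Sf S → Representable B S
model-representable Sf sat base        = _ , represents-B
model-representable Sf sat (gen i)     = BSaturated.D3 (sat i)
model-representable Sf sat (arr mU mV) =
  let rU = model-representable Sf sat mU
      (_ , rV) = model-representable Sf sat mV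
  in _ , represents-⇝ (representable⇒⊆ rU) rV

-- 𝒮^B without ∅: SB B S is definitionally withEmpty (RepresentingSeqs B S).
RepresentingSeqs : Pred Term 0ℓ → Pred Term 0ℓ → Pred (List Term) (Level.suc 0ℓ)
RepresentingSeqs B S Ns =
  Σ (Pred (List Term) 0ℓ) λ X → SeqsOf B X × (S ≐ (X ⇝ˢ B)) × X Ns

⊆-RepresentingSeqs⇝ˢ : S ⊆ B → S ⊆ (RepresentingSeqs B S ⇝ˢ B)
⊆-RepresentingSeqs⇝ˢ S⊆B sM =
  S⊆B sM , λ Ns (_ , _ , (S⊆X⇝B , _) , x) → proj₂ (S⊆X⇝B sM) Ns x

representable⇒≐SB⇝ˢ : Representable B S → S ≐ (SB B S ⇝ˢ B)
representable⇒≐SB⇝ˢ {B} r@(X , X⊆B* , S≐X⇝B) =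
    ⇝ˢ-withEmpty {B = B} ∘ ⊆-RepresentingSeqs⇝ˢ (representable⇒⊆ r)
  , proj₂ S≐X⇝B ∘ ⇝ˢ-antitone {B = B} (λ x → inj₂ (X , X⊆B* , S≐X⇝B , x))

lemma3p12 : (B : Pred Term 0ℓ) → Saturated B →
    {I : Set} (Sf : I → Pred Term 0ℓ) → (∀ i → BSaturated B (Sf i)) →
    (S : Pred Term 0ℓ) → InModel B Sf S →
    S ≐ (SB B S ⇝ˢ B)
lemma3p12 B _ Sf sat S m = representable⇒≐SB⇝ˢ (model-representable Sf sat m)
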